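{- For every integer $n > 1$ and all integers $m, k$, we have $D_{n,m,k} \neq 0$ if and only if $1 \leq k \leq n$ and $n - k \leq m \leq \binom{n}{2} - \binom{k}{2}$.
   Context: A directed ordered acyclic graph (DOAG) is a tuple $(V, E, (\prec_v)_{v \in V \cup \{\emptyset\}})$ where $V$ is a finite set of vertices, $E \subseteq V \times V$ is a set of edges such that the directed graph $(V,E)$ is acyclic, for each $v \in V$, $\prec_v$ is a total order on the set of outgoing edges of $v$, and $\prec_\emptyset$ is a total order on the set of sources of the graph (vertices with no incoming edge). Two DOAGs are considered equal if there is a bijection between their vertex sets preserving the edges and all the orders $\prec_v$ and $\prec_\emptyset$. For integers $n,m,k$, $D_{n,m,k}$ denotes the number of DOAGs (up to this equality) with $n$ vertices, $m$ edges and $k$ sources. -}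

module Defs where

open import Data.Nat using (ℕ)
open import Data.Fin using (Fin)
open import Data.List using (List; length; map; allFin)
open import Data.Nat.ListAction using (sum)
open import Data.List.Membership.Propositional using (_∈_)
open import Data.List.Relation.Unary.Unique.Propositional using (Unique)
open import Data.Product using (Σ; _×_)
open import Relation.Nullary using (¬_)
open import Relation.Binary.Construct.Closure.Transitive using (TransClosure)
open import Function.Bundles using (_⇔_)
open import Relation.Binary.PropositionalEquality using (_≡_)

-- For each vertex v, `out v` lists the targets of the outgoing edges of v,
-- in the order ≺_v (no repetitions, since E is a set of pairs).
-- `srcs` lists the sources in the order ≺_∅.
record DOAG (n : ℕ) : Set where
  field
    out        : Fin n → List (Fin n)
    out-unique : ∀ v → Unique (out v)
  Edge : Fin n → Fin n → Set
  Edge u v = v ∈ out u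
  IsSource : Fin n → Set
  IsSource v = ∀ u → ¬ Edge u v
  field
    acyclic     : ∀ v → ¬ TransClosure Edge v v
    srcs        : List (Fin n)
    srcs-unique : Unique srcs
    srcs-exact  : ∀ v → (v ∈ srcs) ⇔ IsSource v

  numEdges : ℕ
  numEdges = sum (map (λ v → length (out v)) (allFin n))

  numSources : ℕ
  numSources = length srcs

D≢0 : ℕ → ℕ → ℕ → Set
D≢0 n m k = Σ (DOAG n) (λ G → (DOAG.numEdges G ≡ m) × (DOAG.numSources G ≡ k))

-- The edges and the pairs of sources are pairwise distinct unordered pairs of
-- distinct vertices: acyclicity forbids an edge in both directions and no edge ends in a
-- source. Hence m + C(k,2) ≤ C(n,2). Every vertex is a source or the target of an edge,
-- so n ≤ k + m, and following predecessors backwards in an acyclic graph must stop at a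
-- source, so k ≥ 1.
-- Sufficiency. Start from k isolated vertices and repeatedly add a sink whose in-neighbours
-- are the first d + 1 of the N existing vertices (d < N). This keeps k sources and adds any
-- number of edges between 1 and N; these ranges overlap, so every m between n − k and
-- C(n,2) − C(k,2) is reached.
module Submission where

open import Defs
open import Algebra.Properties.CommutativeSemigroup using (interchange)
open import Data.Bool.Base using (true; false; if_then_else_)
open import Data.Empty using (⊥-elim)
open import Data.Fin.Base as Fin using (Fin; zero; suc; toℕ; fromℕ<)
open import Data.Fin.Properties using (pigeonhole; suc-injective; _≟_)
open import Data.List.Base using (List; []; _∷_; _++_; map; length; filter; concat; allFin)
open import Data.List.Properties
  using (length-++; length-map; length-tabulate; map-tabulate; map-∘; map-cong; filter-notAll)
open import Data.List.Membership.Propositional using (_∈_; _∉_; lose)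
open import Data.List.Membership.Propositional.Properties
  using (∈-++⁻; ∈-++⁺ˡ; ∈-++⁺ʳ; ∈-map⁺; ∈-map⁻; ∈-concat⁺′; ∈-concat⁻′; ∈-allFin)
import Data.List.Membership.DecPropositional as DecMembership
import Data.List.Membership.Setoid as SetoidMembership
import Data.List.Membership.Setoid.Properties as SetoidMembershipₚ
open import Data.List.Relation.Binary.Disjoint.Propositional using (Disjoint)
open import Data.List.Relation.Unary.All as All using (All; []; _∷_)
import Data.List.Relation.Unary.All.Properties as All
open import Data.List.Relation.Unary.Any as Any using (here; there; any?; satisfied)
import Data.List.Relation.Unary.Any.Properties as Any
open import Data.List.Relation.Unary.AllPairs as AllPairs using ([]; _∷_)
import Data.List.Relation.Unary.AllPairs.Properties as AllPairs
open import Data.List.Relation.Unary.Unique.Propositional using (Unique)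
import Data.List.Relation.Unary.Unique.Propositional.Properties as Unique
import Data.List.Relation.Unary.Unique.Setoid as SetoidUnique
open import Data.Nat.Base using (ℕ; zero; suc; _+_; _∸_; _≤_; _<_; _<ᵇ_; z≤n; s≤s)
open import Data.Nat.Combinatorics using (_C_; nCk+nC[k+1]≡[n+1]C[k+1]; nC1≡n)
open import Data.Nat.ListAction using (sum)
open import Data.Nat.Properties
  using ( _≤?_; ≤-refl; ≤-trans; <⇒≤; ≰⇒>; n<1+n; m<1+n⇒m<n∨m≡n; n≤0⇒n≡0; m≤m+n; m≤n+m; +-mono-≤
        ; +-commutativeSemigroup; n∸n≡0; m+n∸m≡n; m+n∸n≡m; m∸n+n≡m; m+[n∸m]≡n; +-∸-assoc; ∸-monoˡ-≤
        ; m≤n+o⇒m∸n≤o; m+n≤o⇒m≤o∸n; module ≤-Reasoning)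
open import Data.Product.Base using (∃; ∃₂; _×_; _,_; proj₁; proj₂; swap)
open import Data.Product.Properties using (≡-dec)
open import Data.Sum.Base using (_⊎_; inj₁; inj₂)
open import Function.Base using (_∘_; id)
open import Function.Bundles using (_⇔_; mk⇔; Equivalence)
open import Relation.Binary.Bundles using (DecSetoid)
open import Relation.Binary.Construct.Closure.Transitive using (TransClosure; [_]; _∷_)
open import Relation.Binary.Core using (Rel)
open import Relation.Binary.Definitions using (DecidableEquality)
open import Relation.Binary.PropositionalEquality
  using (_≡_; _≢_; refl; sym; trans; cong; cong₂; subst; subst₂; module ≡-Reasoning)
import Relation.Binary.PropositionalEquality as ≡
open import Relation.Binary.Structures using (IsDecEquivalence)
open import Relation.Nullary using (¬_; yes; no; ¬?; _⊎-dec_)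

module _ {c ℓ} (S : DecSetoid c ℓ) where
  open DecSetoid S using (setoid; _≈_) renaming (_≟_ to _≈?_; trans to ≈-trans; sym to ≈-sym)
  open SetoidMembership setoid using () renaming (_∈_ to _∈ₛ_)
  open SetoidUnique setoid using () renaming (Unique to Uniqueₛ)

  Unique-⊆⇒length≤ : ∀ {xs ys} → Uniqueₛ xs → All (_∈ₛ ys) xs → length xs ≤ length ys
  Unique-⊆⇒length≤ {[]}          _            _               = z≤n
  Unique-⊆⇒length≤ {x ∷ xs} {ys} (x≉xs ∷ xs!) (x∈ys ∷ xs⊆ys) = begin
    suc (length xs)              ≤⟨ s≤s (Unique-⊆⇒length≤ xs! (All.zipWith ∈-rest (x≉xs , xs⊆ys))) ⟩
    suc (length (filter x≉? ys)) ≤⟨ filter-notAll x≉? ys (Any.map (λ x≈y x≉y → x≉y x≈y) x∈ys) ⟩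
    length ys                    ∎
    where
      open ≤-Reasoning
      x≉? = λ y → ¬? (x ≈? y)
      ∈-rest : ∀ {y} → ¬ x ≈ y × y ∈ₛ ys → y ∈ₛ filter x≉? ys
      ∈-rest (x≉y , y∈ys) = SetoidMembershipₚ.∈-filter⁺ setoid x≉?
        (λ y≈z x≉y x≈z → x≉y (≈-trans x≈z (≈-sym y≈z))) y∈ys x≉y

∈⇒1≤length : ∀ {a} {A : Set a} {x : A} {xs} → x ∈ xs → 1 ≤ length xs
∈⇒1≤length {xs = _ ∷ _} _ = s≤s z≤n

length-concat : ∀ {a} {A : Set a} (xss : List (List A)) → length (concat xss) ≡ sum (map length xss)
length-concat []         = refl
length-concat (xs ∷ xss) = trans (length-++ xs) (cong (length xs +_) (length-concat xss))

sum-map-0 : ∀ {a} {A : Set a} (xs : List A) → sum (map (λ _ → 0) xs) ≡ 0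
sum-map-0 []       = refl
sum-map-0 (_ ∷ xs) = sum-map-0 xs

sum-map-+ : ∀ {a} {A : Set a} (f g : A → ℕ) (xs : List A) →
            sum (map (λ x → f x + g x) xs) ≡ sum (map f xs) + sum (map g xs)
sum-map-+ f g []       = refl
sum-map-+ f g (x ∷ xs) = trans (cong (f x + g x +_) (sum-map-+ f g xs))
                               (interchange +-commutativeSemigroup (f x) (g x) _ _)

map-allFin-suc : ∀ {a} {A : Set a} {n} (f : Fin (suc n) → A) →
                 map f (allFin (suc n)) ≡ f zero ∷ map (f ∘ suc) (allFin n)
map-allFin-suc f = trans (map-tabulate id f) (cong (f zero ∷_) (sym (map-tabulate id (f ∘ suc))))

sum-map-toℕ<ᵇ : ∀ {n} c → c ≤ n → sum (map (λ (u : Fin n) → if toℕ u <ᵇ c then 1 else 0) (allFin n)) ≡ c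
sum-map-toℕ<ᵇ {n}     zero    _         = sum-map-0 (allFin n)
sum-map-toℕ<ᵇ {suc n} (suc c) (s≤s c≤n) =
  trans (cong sum (map-allFin-suc {n = n} (λ u → if toℕ u <ᵇ suc c then 1 else 0)))
        (cong suc (sum-map-toℕ<ᵇ c c≤n))

zero∉map-suc : ∀ {n} {xs : List (Fin n)} → zero ∉ map suc xs
zero∉map-suc z∈ with ∈-map⁻ Fin.suc z∈
... | _ , _ , ()

suc∈map-suc⁻ : ∀ {n} {v : Fin n} {xs} → suc v ∈ map suc xs → v ∈ xs
suc∈map-suc⁻ = Any.map suc-injective ∘ Any.map⁻

[1+n]C2≡n+nC2 : ∀ n → suc n C 2 ≡ n + n C 2
[1+n]C2≡n+nC2 n = trans (sym (nCk+nC[k+1]≡[n+1]C[k+1] n 1)) (cong (_+ n C 2) (nC1≡n n))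

pairs : ∀ {a} {A : Set a} → List A → List (A × A)
pairs []       = []
pairs (x ∷ xs) = map (x ,_) xs ++ pairs xs

module _ {a} {A : Set a} where

  length-pairs : (xs : List A) → length (pairs xs) ≡ length xs C 2
  length-pairs []       = refl
  length-pairs (x ∷ xs) = begin
    length (map (x ,_) xs ++ pairs xs)          ≡⟨ length-++ (map (x ,_) xs) ⟩
    length (map (x ,_) xs) + length (pairs xs)  ≡⟨ cong₂ _+_ (length-map (x ,_) xs) (length-pairs xs) ⟩
    length xs + length xs C 2                   ≡⟨ [1+n]C2≡n+nC2 (length xs) ⟨
    suc (length xs) C 2                         ∎
    where open ≡-Reasoning

  ∈-pairs⁻ : ∀ {x y : A} {xs} → (x , y) ∈ pairs xs → x ∈ xs × y ∈ xs
  ∈-pairs⁻ {xs = z ∷ zs} xy∈ with ∈-++⁻ (map (z ,_) zs) xy∈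
  ... | inj₁ xy∈map with ∈-map⁻ _ xy∈map
  ...   | _ , y∈zs , refl = here refl , there y∈zs
  ∈-pairs⁻ {xs = z ∷ zs} xy∈ | inj₂ xy∈pairs with ∈-pairs⁻ xy∈pairs
  ...   | x∈zs , y∈zs = there x∈zs , there y∈zs

  pairs-unique : ∀ {xs : List A} → Unique xs → Unique (pairs xs)
  pairs-unique {[]}     []           = []
  pairs-unique {x ∷ xs} (x∉xs ∷ xs!) =
    Unique.++⁺ (Unique.map⁺ (cong proj₂) xs!) (pairs-unique xs!) disjoint
    where
      disjoint : Disjoint (map (x ,_) xs) (pairs xs)
      disjoint (p∈map , p∈pairs) with ∈-map⁻ _ p∈map
      ... | _ , _ , refl = All.lookup x∉xs (proj₁ (∈-pairs⁻ p∈pairs)) refl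

  pairs-swap-free : ∀ {xs : List A} → Unique xs → ∀ {p} → p ∈ pairs xs → swap p ∉ pairs xs
  pairs-swap-free {x ∷ xs} (x∉xs ∷ xs!) p∈ swap-p∈
    with ∈-++⁻ (map (x ,_) xs) p∈ | ∈-++⁻ (map (x ,_) xs) swap-p∈
  ... | inj₁ p∈map | inj₁ q∈map with ∈-map⁻ _ p∈map | ∈-map⁻ _ q∈map
  ...   | _ , y∈xs , refl | _ , _ , refl = All.lookup x∉xs y∈xs refl
  pairs-swap-free (x∉xs ∷ xs!) p∈ swap-p∈ | inj₁ p∈map | inj₂ q∈pairs with ∈-map⁻ _ p∈map
  ...   | _ , _ , refl = All.lookup x∉xs (proj₂ (∈-pairs⁻ q∈pairs)) refl
  pairs-swap-free (x∉xs ∷ xs!) p∈ swap-p∈ | inj₂ p∈pairs | inj₁ q∈map with ∈-map⁻ _ q∈map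
  ...   | _ , _ , refl = All.lookup x∉xs (proj₂ (∈-pairs⁻ p∈pairs)) refl
  pairs-swap-free (x∉xs ∷ xs!) p∈ swap-p∈ | inj₂ p∈pairs | inj₂ q∈pairs =
    pairs-swap-free xs! p∈pairs q∈pairs

module UnorderedPairs {a} {A : Set a} (_≟_ : DecidableEquality A) where

  infix 4 _≈ᵤ_
  _≈ᵤ_ : Rel (A × A) a
  p ≈ᵤ q = p ≡ q ⊎ p ≡ swap q

  ≈ᵤ-isDecEquivalence : IsDecEquivalence _≈ᵤ_
  ≈ᵤ-isDecEquivalence = record
    { isEquivalence = record { refl = inj₁ refl ; sym = ≈ᵤ-sym ; trans = ≈ᵤ-trans }
    ; _≟_           = λ p q → ≡-dec _≟_ _≟_ p q ⊎-dec ≡-dec _≟_ _≟_ p (swap q)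
    }
    where
      ≈ᵤ-sym : ∀ {p q} → p ≈ᵤ q → q ≈ᵤ p
      ≈ᵤ-sym (inj₁ refl) = inj₁ refl
      ≈ᵤ-sym (inj₂ refl) = inj₂ refl
      ≈ᵤ-trans : ∀ {p q r} → p ≈ᵤ q → q ≈ᵤ r → p ≈ᵤ r
      ≈ᵤ-trans (inj₁ refl) q≈r         = q≈r
      ≈ᵤ-trans (inj₂ refl) (inj₁ refl) = inj₂ refl
      ≈ᵤ-trans (inj₂ refl) (inj₂ refl) = inj₁ refl

  decSetoid : DecSetoid a a
  decSetoid = record { isDecEquivalence = ≈ᵤ-isDecEquivalence }

  open SetoidMembership (DecSetoid.setoid decSetoid) public using () renaming (_∈_ to _∈ᵤ_)
  open SetoidUnique (DecSetoid.setoid decSetoid) public using () renaming (Unique to Uniqueᵤ)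

  Unique⇒Uniqueᵤ : ∀ {ps} → Unique ps → (∀ {p} → p ∈ ps → swap p ∉ ps) → Uniqueᵤ ps
  Unique⇒Uniqueᵤ {[]}     []           _     = []
  Unique⇒Uniqueᵤ {p ∷ ps} (p∉ps ∷ ps!) swap∉ =
    All.tabulate p≉ᵤ ∷ Unique⇒Uniqueᵤ ps! (λ q∈ps swap-q∈ps → swap∉ (there q∈ps) (there swap-q∈ps))
    where
      p≉ᵤ : ∀ {q} → q ∈ ps → ¬ p ≈ᵤ q
      p≉ᵤ q∈ps (inj₁ p≡q)      = All.lookup p∉ps q∈ps p≡q
      p≉ᵤ q∈ps (inj₂ p≡swap-q) = swap∉ (there q∈ps) (here (sym p≡swap-q))

  ∈ᵤ-pairs : ∀ {x y : A} {xs} → x ≢ y → x ∈ xs → y ∈ xs → (x , y) ∈ᵤ pairs xs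
  ∈ᵤ-pairs x≢y (here refl)  (here refl)  = ⊥-elim (x≢y refl)
  ∈ᵤ-pairs _   (here refl)  (there y∈xs) = Any.map inj₁ (∈-++⁺ˡ (∈-map⁺ _ y∈xs))
  ∈ᵤ-pairs _   (there x∈xs) (here refl)  = Any.map (λ { refl → inj₂ refl }) (∈-++⁺ˡ (∈-map⁺ _ x∈xs))
  ∈ᵤ-pairs {xs = z ∷ zs} x≢y (there x∈xs) (there y∈xs) =
    SetoidMembershipₚ.∈-++⁺ʳ (DecSetoid.setoid decSetoid) (map (z ,_) zs) (∈ᵤ-pairs x≢y x∈xs y∈xs)

-- Necessary conditions

cycle-if-all-have-predecessors : ∀ {n ℓ} (R : Rel (Fin n) ℓ) →
                                 Fin n → (∀ v → ∃ λ u → R u v) → ∃ λ v → TransClosure R v v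
-- The backward walk w 0, w 1, …, w n has n + 1 entries, so it repeats a vertex.
cycle-if-all-have-predecessors {n} R v₀ pred = close (pigeonhole (n<1+n n) (w ∘ toℕ))
  where
    w : ℕ → Fin n
    w zero    = v₀
    w (suc i) = proj₁ (pred (w i))
    walk : ∀ {i j} → i < j → TransClosure R (w j) (w i)
    walk {i} {suc j} i<1+j with m<1+n⇒m<n∨m≡n i<1+j
    ... | inj₂ refl = [ proj₂ (pred (w i)) ]
    ... | inj₁ i<j  = proj₂ (pred (w j)) ∷ walk i<j
    close : (∃₂ λ i j → toℕ i < toℕ j × w (toℕ i) ≡ w (toℕ j)) → ∃ λ v → TransClosure R v v
    close (i , j , i<j , wᵢ≡wⱼ) =
      w (toℕ i) , subst (λ v → TransClosure R v (w (toℕ i))) (sym wᵢ≡wⱼ) (walk i<j)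

module _ {n : ℕ} (G : DOAG n) where
  open DOAG G
  open DecMembership (_≟_ {n}) using (_∈?_)
  open UnorderedPairs (_≟_ {n})

  outEdges : Fin n → List (Fin n × Fin n)
  outEdges u = map (u ,_) (out u)

  edges : List (Fin n × Fin n)
  edges = concat (map outEdges (allFin n))

  length-edges : length edges ≡ numEdges
  length-edges = begin
    length (concat (map outEdges (allFin n)))   ≡⟨ length-concat (map outEdges (allFin n)) ⟩
    sum (map length (map outEdges (allFin n)))  ≡⟨ cong sum (map-∘ (allFin n)) ⟨
    sum (map (length ∘ outEdges) (allFin n))    ≡⟨ cong sum (map-cong (λ u → length-map (u ,_) (out u)) (allFin n)) ⟩
    numEdges                                    ∎
    where open ≡-Reasoning

  ∈-edges⁻ : ∀ {u v} → (u , v) ∈ edges → Edge u v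
  ∈-edges⁻ uv∈ with ∈-concat⁻′ (map outEdges (allFin n)) uv∈
  ... | es , uv∈es , es∈ with ∈-map⁻ outEdges es∈
  ...   | _ , _ , refl with ∈-map⁻ _ uv∈es
  ...     | _ , v∈out , refl = v∈out

  ∈-edges⁺ : ∀ {u v} → Edge u v → (u , v) ∈ edges
  ∈-edges⁺ {u} e = ∈-concat⁺′ (∈-map⁺ _ e) (∈-map⁺ outEdges (∈-allFin u))

  edges-unique : Unique edges
  edges-unique = Unique.concat⁺
    (All.map⁺ (All.tabulate (λ {u} _ → Unique.map⁺ (cong proj₂) (out-unique u))))
    (AllPairs.map⁺ (AllPairs.map outEdges-disjoint (Unique.allFin⁺ n)))
    where
      outEdges-disjoint : ∀ {u w} → u ≢ w → Disjoint (outEdges u) (outEdges w)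
      outEdges-disjoint u≢w (p∈u , p∈w) with ∈-map⁻ _ p∈u | ∈-map⁻ _ p∈w
      ... | _ , _ , refl | _ , _ , refl = u≢w refl

  source⇒¬Edge : ∀ {u v} → v ∈ srcs → ¬ Edge u v
  source⇒¬Edge {u} {v} v∈srcs = Equivalence.to (srcs-exact v) v∈srcs u

  source-or-target : ∀ v → v ∈ srcs ⊎ ∃ λ u → Edge u v
  source-or-target v with any? (λ u → v ∈? out u) (allFin n)
  ... | yes has-pred = inj₂ (satisfied has-pred)
  ... | no  no-pred  = inj₁ (Equivalence.from (srcs-exact v) (λ u e → no-pred (lose (∈-allFin u) e)))

  edges++sourcePairs-swap-free : ∀ {p} → p ∈ edges ++ pairs srcs → swap p ∉ edges ++ pairs srcs
  edges++sourcePairs-swap-free {u , v} uv∈ vu∈ with ∈-++⁻ edges uv∈ | ∈-++⁻ edges vu∈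
  ... | inj₁ uv∈edges | inj₁ vu∈edges = acyclic u (∈-edges⁻ uv∈edges ∷ [ ∈-edges⁻ vu∈edges ])
  ... | inj₁ uv∈edges | inj₂ vu∈pairs = source⇒¬Edge (proj₁ (∈-pairs⁻ vu∈pairs)) (∈-edges⁻ uv∈edges)
  ... | inj₂ uv∈pairs | inj₁ vu∈edges = source⇒¬Edge (proj₁ (∈-pairs⁻ uv∈pairs)) (∈-edges⁻ vu∈edges)
  ... | inj₂ uv∈pairs | inj₂ vu∈pairs = pairs-swap-free srcs-unique uv∈pairs vu∈pairs

  edges++sourcePairs-unique : Unique (edges ++ pairs srcs)
  edges++sourcePairs-unique = Unique.++⁺ edges-unique (pairs-unique srcs-unique) disjoint
    where
      disjoint : Disjoint edges (pairs srcs)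
      disjoint {u , v} (uv∈edges , uv∈pairs) =
        source⇒¬Edge (proj₂ (∈-pairs⁻ uv∈pairs)) (∈-edges⁻ uv∈edges)

  numEdges+numSourcesC2≤nC2 : numEdges + numSources C 2 ≤ n C 2
  numEdges+numSourcesC2≤nC2 = subst₂ _≤_ length-edges++sourcePairs length-allPairs
    (Unique-⊆⇒length≤ decSetoid
      (Unique⇒Uniqueᵤ edges++sourcePairs-unique edges++sourcePairs-swap-free)
      (All.tabulate λ uv∈ → ∈ᵤ-pairs (distinct-ends uv∈) (∈-allFin _) (∈-allFin _)))
    where
      distinct-ends : ∀ {u v} → (u , v) ∈ edges ++ pairs srcs → u ≢ v
      distinct-ends uv∈ refl = edges++sourcePairs-swap-free uv∈ uv∈
      length-edges++sourcePairs : length (edges ++ pairs srcs) ≡ numEdges + numSources C 2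
      length-edges++sourcePairs = trans (length-++ edges) (cong₂ _+_ length-edges (length-pairs srcs))
      length-allPairs : length (pairs (allFin n)) ≡ n C 2
      length-allPairs = trans (length-pairs (allFin n)) (cong (_C 2) (length-tabulate {n = n} id))

  n≤numSources+numEdges : n ≤ numSources + numEdges
  n≤numSources+numEdges = subst₂ _≤_ (length-tabulate {n = n} id) length-srcs++targets
    (Unique-⊆⇒length≤ (≡.decSetoid _≟_) (Unique.allFin⁺ n) (All.tabulate λ {v} _ → source-or-target∈ v))
    where
      source-or-target∈ : ∀ v → v ∈ srcs ++ map proj₂ edges
      source-or-target∈ v with source-or-target v
      ... | inj₁ v∈srcs  = ∈-++⁺ˡ v∈srcs
      ... | inj₂ (_ , e) = ∈-++⁺ʳ srcs (∈-map⁺ proj₂ (∈-edges⁺ e))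
      length-srcs++targets : length (srcs ++ map proj₂ edges) ≡ numSources + numEdges
      length-srcs++targets =
        trans (length-++ srcs) (cong (numSources +_) (trans (length-map proj₂ edges) length-edges))

  numSources≤n : numSources ≤ n
  numSources≤n = subst (numSources ≤_) (length-tabulate {n = n} id)
    (Unique-⊆⇒length≤ (≡.decSetoid _≟_) srcs-unique (All.tabulate λ {v} _ → ∈-allFin v))

  1≤numSources : 1 ≤ n → 1 ≤ numSources
  1≤numSources 1≤n with any? (_∈? srcs) (allFin n)
  ... | yes some-source = ∈⇒1≤length (proj₂ (satisfied some-source))
  ... | no  no-source   = ⊥-elim (acyclic (proj₁ cycle) (proj₂ cycle))
    where
      predecessor : ∀ v → ∃ λ u → Edge u v
      predecessor v with source-or-target v
      ... | inj₁ v∈srcs = ⊥-elim (no-source (lose (∈-allFin v) v∈srcs))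
      ... | inj₂ has-pred = has-pred
      cycle = cycle-if-all-have-predecessors Edge (fromℕ< 1≤n) predecessor

necessary : ∀ {n m k} → 1 ≤ n → D≢0 n m k → (1 ≤ k × k ≤ n) × (n ∸ k ≤ m × m ≤ (n C 2) ∸ (k C 2))
necessary {n} 1≤n (G , refl , refl) =
  (1≤numSources G 1≤n , numSources≤n G) ,
  (m≤n+o⇒m∸n≤o n _ (n≤numSources+numEdges G) , m+n≤o⇒m≤o∸n _ (numEdges+numSourcesC2≤nC2 G))

-- Constructions

discrete : (k : ℕ) → DOAG k
discrete k = record
  { out         = λ _ → []
  ; out-unique  = λ _ → []
  ; acyclic     = λ { _ [ () ] ; _ (() ∷ _) }
  ; srcs        = allFin k
  ; srcs-unique = Unique.allFin⁺ k
  ; srcs-exact  = λ v → mk⇔ (λ _ _ ()) (λ _ → ∈-allFin v)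
  }

discrete-D≢0 : ∀ k → D≢0 k 0 k
discrete-D≢0 k = discrete k , sum-map-0 (allFin k) , length-tabulate {n = k} id

module AttachSink {n : ℕ} (G : DOAG n) (d : ℕ) where
  open DOAG G

  -- The new vertex is zero; its in-neighbours are the old vertices u with toℕ u ≤ d.
  out⁺ : Fin (suc n) → List (Fin (suc n))
  out⁺ zero    = []
  out⁺ (suc u) = if toℕ u <ᵇ suc d then zero ∷ map suc (out u) else map suc (out u)

  Edge⁺ : Fin (suc n) → Fin (suc n) → Set
  Edge⁺ u v = v ∈ out⁺ u

  out⁺-unique : ∀ v → Unique (out⁺ v)
  out⁺-unique zero = []
  out⁺-unique (suc u) with toℕ u <ᵇ suc d
  ... | true  = All.tabulate (λ { z∈ refl → zero∉map-suc z∈ }) ∷ Unique.map⁺ suc-injective (out-unique u)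
  ... | false = Unique.map⁺ suc-injective (out-unique u)

  Edge⁺-suc⁻ : ∀ {u v} → Edge⁺ (suc u) (suc v) → Edge u v
  Edge⁺-suc⁻ {u} e with toℕ u <ᵇ suc d
  Edge⁺-suc⁻ (there e) | true  = suc∈map-suc⁻ e
  Edge⁺-suc⁻ e        | false = suc∈map-suc⁻ e

  Edge⁺-suc⁺ : ∀ {u v} → Edge u v → Edge⁺ (suc u) (suc v)
  Edge⁺-suc⁺ {u} e with toℕ u <ᵇ suc d
  ... | true  = there (∈-map⁺ Fin.suc e)
  ... | false = ∈-map⁺ Fin.suc e

  length-out⁺-suc : ∀ u → length (out⁺ (suc u)) ≡ (if toℕ u <ᵇ suc d then 1 else 0) + length (out u)
  length-out⁺-suc u with toℕ u <ᵇ suc d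
  ... | true  = cong suc (length-map Fin.suc (out u))
  ... | false = length-map Fin.suc (out u)

  no-path-from-zero : ∀ {v} → ¬ TransClosure Edge⁺ zero v
  no-path-from-zero [ () ]
  no-path-from-zero (() ∷ _)

  path⁺-suc⁻ : ∀ {u v} → TransClosure Edge⁺ (suc u) (suc v) → TransClosure Edge u v
  path⁺-suc⁻ [ e ]                = [ Edge⁺-suc⁻ e ]
  path⁺-suc⁻ (_∷_ {y = zero} _ p)  = ⊥-elim (no-path-from-zero p)
  path⁺-suc⁻ (_∷_ {y = suc _} e p) = Edge⁺-suc⁻ e ∷ path⁺-suc⁻ p

  acyclic⁺ : ∀ v → ¬ TransClosure Edge⁺ v v
  acyclic⁺ zero    = no-path-from-zero
  acyclic⁺ (suc v) = acyclic v ∘ path⁺-suc⁻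

  srcs⁺-exact : d < n → ∀ v → (v ∈ map suc srcs) ⇔ (∀ u → ¬ Edge⁺ u v)
  srcs⁺-exact (s≤s _) zero =
    mk⇔ (⊥-elim ∘ zero∉map-suc) (λ zero-source → ⊥-elim (zero-source (suc zero) (here refl)))
  srcs⁺-exact _ (suc v) = mk⇔
    (λ sv∈ → λ { zero () ; (suc u) e → Equivalence.to (srcs-exact v) (suc∈map-suc⁻ sv∈) u (Edge⁺-suc⁻ e) })
    (λ source → ∈-map⁺ Fin.suc (Equivalence.from (srcs-exact v) (λ u e → source (suc u) (Edge⁺-suc⁺ e))))

  attachSink : d < n → DOAG (suc n)
  attachSink d<n = record
    { out         = out⁺
    ; out-unique  = out⁺-unique
    ; acyclic     = acyclic⁺
    ; srcs        = map Fin.suc srcs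
    ; srcs-unique = Unique.map⁺ suc-injective srcs-unique
    ; srcs-exact  = srcs⁺-exact d<n
    }

  numEdges-attachSink : (d<n : d < n) → DOAG.numEdges (attachSink d<n) ≡ suc d + numEdges
  numEdges-attachSink d<n = begin
    sum (map (length ∘ out⁺) (allFin (suc n)))
      ≡⟨ cong sum (map-allFin-suc (length ∘ out⁺)) ⟩
    sum (map (λ u → length (out⁺ (suc u))) (allFin n))
      ≡⟨ cong sum (map-cong length-out⁺-suc (allFin n)) ⟩
    sum (map (λ u → (if toℕ u <ᵇ suc d then 1 else 0) + length (out u)) (allFin n))
      ≡⟨ sum-map-+ (λ u → if toℕ u <ᵇ suc d then 1 else 0) (length ∘ out) (allFin n) ⟩
    sum (map (λ u → if toℕ u <ᵇ suc d then 1 else 0) (allFin n)) + numEdges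
      ≡⟨ cong (_+ numEdges) (sum-map-toℕ<ᵇ (suc d) d<n) ⟩
    suc d + numEdges
      ∎
    where open ≡-Reasoning

attachSink-D≢0 : ∀ {n m k} → D≢0 n m k → ∀ d → d < n → D≢0 (suc n) (suc d + m) k
attachSink-D≢0 (G , refl , refl) d d<n =
  attachSink d<n , numEdges-attachSink d<n , length-map Fin.suc (DOAG.srcs G)
  where open AttachSink G d

-- Sufficient conditions

+-split : ∀ {a b c e m} → a ≤ b → c ≤ e → c + a ≤ m → m ≤ e + b →
          ∃₂ λ y x → (c ≤ y × y ≤ e) × (a ≤ x × x ≤ b) × y + x ≡ m
+-split {a} {b} {c} {e} {m} a≤b c≤e c+a≤m m≤e+b with m ≤? c + b
... | yes m≤c+b = c , m ∸ c , (≤-refl , c≤e) , (a≤m∸c , m≤n+o⇒m∸n≤o m c m≤c+b) , m+[n∸m]≡n c≤m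
  where
    c≤m = ≤-trans (m≤m+n c a) c+a≤m
    a≤m∸c = subst (_≤ m ∸ c) (m+n∸m≡n c a) (∸-monoˡ-≤ c c+a≤m)
... | no m≰c+b = m ∸ b , b , (c≤m∸b , m∸b≤e) , (a≤b , ≤-refl) , m∸n+n≡m b≤m
  where
    c+b≤m = <⇒≤ (≰⇒> m≰c+b)
    c≤m∸b = m+n≤o⇒m≤o∸n c c+b≤m
    m∸b≤e = subst (m ∸ b ≤_) (m+n∸n≡m e b) (∸-monoˡ-≤ b m≤e+b)
    b≤m = ≤-trans (m≤n+m b c) c+b≤m

-- The bound C(n,2) − C(k,2) for n = j + suc k vertices and suc k sources.
maxEdges : ℕ → ℕ → ℕ
maxEdges j k = (j + suc k) C 2 ∸ suc k C 2

j+[1+k]C2≤[j+1+k]C2 : ∀ j k → j + suc k C 2 ≤ (j + suc k) C 2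
j+[1+k]C2≤[j+1+k]C2 zero    k = ≤-refl
j+[1+k]C2≤[j+1+k]C2 (suc j) k = begin
  1 + (j + suc k C 2)            ≤⟨ +-mono-≤ (≤-trans (s≤s z≤n) (m≤n+m (suc k) j)) (j+[1+k]C2≤[j+1+k]C2 j k) ⟩
  j + suc k + (j + suc k) C 2    ≡⟨ [1+n]C2≡n+nC2 (j + suc k) ⟨
  (suc j + suc k) C 2            ∎
  where open ≤-Reasoning

j≤maxEdges : ∀ j k → j ≤ maxEdges j k
j≤maxEdges j k = m+n≤o⇒m≤o∸n j (j+[1+k]C2≤[j+1+k]C2 j k)

maxEdges-suc : ∀ j k → maxEdges (suc j) k ≡ (j + suc k) + maxEdges j k
maxEdges-suc j k = trans (cong (_∸ suc k C 2) ([1+n]C2≡n+nC2 (j + suc k)))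
                         (+-∸-assoc (j + suc k) (≤-trans (m≤n+m (suc k C 2) j) (j+[1+k]C2≤[j+1+k]C2 j k)))

realisable : ∀ k j {m} → j ≤ m → m ≤ maxEdges j k → D≢0 (j + suc k) m (suc k)
realisable k zero {m} _ m≤0 =
  subst (λ m → D≢0 (suc k) m (suc k)) (sym (n≤0⇒n≡0 (subst (m ≤_) (n∸n≡0 (suc k C 2)) m≤0)))
    (discrete-D≢0 (suc k))
realisable k (suc j) {m} 1+j≤m m≤max
  with +-split (j≤maxEdges j k) (≤-trans (s≤s z≤n) (m≤n+m (suc k) j)) 1+j≤m
                (subst (m ≤_) (maxEdges-suc j k) m≤max)
... | zero  , _ , (() , _) , _
... | suc d , x , (_ , d<n) , (j≤x , x≤max) , y+x≡m =
  subst (λ m → D≢0 (suc j + suc k) m (suc k)) y+x≡m (attachSink-D≢0 (realisable k j j≤x x≤max) d d<n)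

sufficient : ∀ {n m k} → 1 ≤ k → k ≤ n → n ∸ k ≤ m → m ≤ (n C 2) ∸ (k C 2) → D≢0 n m k
sufficient {n} {m} {suc k} _ k≤n n∸k≤m m≤max =
  subst (λ n → D≢0 n m (suc k)) n∸k+k≡n
    (realisable k (n ∸ suc k) n∸k≤m (subst (λ n → m ≤ n C 2 ∸ suc k C 2) (sym n∸k+k≡n) m≤max))
  where n∸k+k≡n = m∸n+n≡m k≤n

lemma2p3 : (n m k : ℕ) → 1 < n →
    D≢0 n m k ⇔ ((1 ≤ k × k ≤ n) × (n ∸ k ≤ m × m ≤ (n C 2) ∸ (k C 2)))
lemma2p3 n m k 1<n = mk⇔ (necessary (<⇒≤ 1<n))
  (λ ((1≤k , k≤n) , (n∸k≤m , m≤max)) → sufficient 1≤k k≤n n∸k≤m m≤max)
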